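{- For every $\mathbf{Lb^{*}}$ sequent $\Gamma\to C$, $d(\Omega_{\Gamma\to C})\le\mathrm{ord}(\Gamma\to C)$.
   Context: Formulas of $\mathbf{Lb^{*}}$: built from variables by $\backslash$, $/$, $\cdot$, $\langle\rangle$, $\Box^{\downarrow}$; meta-formulas from formulas by comma and bracketing $[\Gamma]$; a sequent is $\Gamma\to C$. Order: $\mathrm{prod}(A)=1$ if $A$ is $A_1\cdot A_2$ or $\langle\rangle A_1$, else $0$; $\mathrm{ord}(p_i)=0$; $\mathrm{ord}(A\cdot B)=\max\{\mathrm{ord}(A),\mathrm{ord}(B)\}$; $\mathrm{ord}(A\backslash B)=\mathrm{ord}(B/A)=\max\{\mathrm{ord}(A)+1,\mathrm{ord}(B)+\mathrm{prod}(B)\}$; $\mathrm{ord}(\langle\rangle A)=\mathrm{ord}(A)$; $\mathrm{ord}(\Box^{\downarrow}A)=\max\{\mathrm{ord}(A)+\mathrm{prod}(A),1\}$; $\mathrm{ord}$ of the empty meta-formula is $0$; $\mathrm{ord}(\Gamma,\Delta)=\max\{\mathrm{ord}(\Gamma),\mathrm{ord}(\Delta)\}$; $\mathrm{ord}([\Gamma])=\mathrm{ord}(\Gamma)$; $\mathrm{ord}(\Gamma\to C)=\max\{\mathrm{ord}(\Gamma)+1,\mathrm{ord}(C)+\mathrm{prod}(C)\}$. Translations (into expressions built from literals $p_i,\bar p_i,[,],\bar{[},\bar{]}$ with $⅋$, $\otimes$, $\diamond$): $p_i^+=p_i$, $p_i^-=\bar p_i$; $(A\cdot B)^+=A^+\otimes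 B^+$, $(A\cdot B)^-=B^-⅋A^-$; $(A\backslash B)^+=A^-⅋B^+$, $(A\backslash B)^-=B^-\otimes A^+$; $(B/A)^+=B^+⅋A^-$, $(B/A)^-=A^+\otimes B^-$; $(\langle\rangle A)^+={]}\otimes(A^+\otimes{[})$, $(\langle\rangle A)^-=(\bar{[}⅋A^-)⅋\bar{]}$; $(\Box^{\downarrow}A)^+=(\bar{]}⅋A^+)⅋\bar{[}$, $(\Box^{\downarrow}A)^-={[}\otimes(A^-\otimes{]})$. Meta-formulas: $(\Gamma,\Delta)^-=\Delta^-\diamond\Gamma^-$, $[\Gamma]^-=\bar{[}\diamond\Gamma^-\diamond\bar{]}$. $\Omega_{\Gamma\to C}$ is the expression $\diamond\Gamma^-\diamond C^+$ (or $\diamond C^+$ if $\Gamma$ is empty). Connective alternation depth: $\mathrm{prod}(\gamma)=1$ if $\gamma$ is of the form $\gamma_1\otimes\gamma_2$, else $0$; $d(q)=d(\bar q)=0$ for literals; $d(\gamma_1⅋\gamma_2)=d(\gamma_1\diamond\gamma_2)=\max\{d(\gamma_1)+\mathrm{prod}(\gamma_1),d(\gamma_2)+\mathrm{prod}(\gamma_2)\}$; $d(\gamma_1\otimes\gamma_2)=\max\{d(\gamma_1),d(\gamma_2)\}$. Accordingly, for $\Omega_{\Gamma\to C}=\diamond\gamma_1\diamond\cdots\diamond\gamma_m$ where the $\gamma_i$ are the top-level components (formula translations and bracket literals), $d(\Omega_{\Gamma\to C})=\max_i\{d(\gamma_i)+\mathrm{prod}(\gamma_i)\}$. -}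

module Defs where

open import Data.Nat using (ℕ; zero; suc; _+_; _⊔_; _≤_)
open import Data.List using (List; []; _∷_; _++_; foldr; map)

data Formula : Set where
  var  : ℕ → Formula
  _⧵_  : Formula → Formula → Formula
  _⁄_  : Formula → Formula → Formula
  _·_  : Formula → Formula → Formula
  ⟨⟩_  : Formula → Formula
  □↓_  : Formula → Formula

data Meta : Set where
  ε    : Meta
  fm   : Formula → Meta
  _,,_ : Meta → Meta → Meta
  [_]  : Meta → Meta

record Sequent : Set where
  constructor _⇒_
  field
    ante : Meta
    succ : Formula

prodF : Formula → ℕ
prodF (_ · _) = 1
prodF (⟨⟩ _)  = 1
prodF _       = 0

ord : Formula → ℕ
ord (var _) = 0
ord (A · B) = ord A ⊔ ord B
ord (A ⧵ B) = suc (ord A) ⊔ (ord B + prodF B)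
ord (B ⁄ A) = suc (ord A) ⊔ (ord B + prodF B)
ord (⟨⟩ A)  = ord A
ord (□↓ A)  = (ord A + prodF A) ⊔ 1

ordM : Meta → ℕ
ordM ε        = 0
ordM (fm A)   = ord A
ordM (Γ ,, Δ) = ordM Γ ⊔ ordM Δ
ordM [ Γ ]    = ordM Γ

ordS : Sequent → ℕ
ordS (Γ ⇒ C) = suc (ordM Γ) ⊔ (ord C + prodF C)

data Lit : Set where
  p    : ℕ → Lit
  p̄    : ℕ → Lit
  lb   : Lit
  rb   : Lit
  lb̄   : Lit
  rb̄   : Lit

data Expr : Set where
  lit : Lit → Expr
  _⅋_ : Expr → Expr → Expr
  _⊗_ : Expr → Expr → Expr
  _⋄_ : Expr → Expr → Expr

mutual
  pos : Formula → Expr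
  pos (var i) = lit (p i)
  pos (A · B) = pos A ⊗ pos B
  pos (A ⧵ B) = neg A ⅋ pos B
  pos (B ⁄ A) = pos B ⅋ neg A
  pos (⟨⟩ A)  = lit rb ⊗ (pos A ⊗ lit lb)
  pos (□↓ A)  = (lit rb̄ ⅋ pos A) ⅋ lit lb̄

  neg : Formula → Expr
  neg (var i) = lit (p̄ i)
  neg (A · B) = neg B ⅋ neg A
  neg (A ⧵ B) = neg B ⊗ pos A
  neg (B ⁄ A) = pos A ⊗ neg B
  neg (⟨⟩ A)  = (lit lb̄ ⅋ neg A) ⅋ lit rb̄
  neg (□↓ A)  = lit lb ⊗ (neg A ⊗ lit rb)

-- Γ⁻ as the list of its top-level ⋄-components (the ⋄-structure is
-- associative at top level): (Γ,Δ)⁻ = Δ⁻ ⋄ Γ⁻, [Γ]⁻ = [̄ ⋄ Γ⁻ ⋄ ]̄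
negM : Meta → List Expr
negM ε        = []
negM (fm A)   = neg A ∷ []
negM (Γ ,, Δ) = negM Δ ++ negM Γ
negM [ Γ ]    = lit lb̄ ∷ (negM Γ ++ (lit rb̄ ∷ []))

-- Ω_{Γ→C} = ⋄ γ₁ ⋄ ⋯ ⋄ γₘ, given by its list of top-level components
Ω : Sequent → List Expr
Ω (Γ ⇒ C) = negM Γ ++ (pos C ∷ [])

prodE : Expr → ℕ
prodE (_ ⊗ _) = 1
prodE _       = 0

d : Expr → ℕ
d (lit _) = 0
d (a ⅋ b) = (d a + prodE a) ⊔ (d b + prodE b)
d (a ⋄ b) = (d a + prodE a) ⊔ (d b + prodE b)
d (a ⊗ b) = d a ⊔ d b

-- d(⋄γ₁⋄⋯⋄γₘ) = max_i (d(γ_i) + prod(γ_i))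
dΩ : List Expr → ℕ
dΩ = foldr (λ γ r → (d γ + prodE γ) ⊔ r) 0

module Submission where

-- Write w(γ) = d(γ) + prod(γ) for the weight of an expression γ as seen
-- from a ⅋- or ⋄-parent, so that d(γ₁ ⅋ γ₂) = w(γ₁) ⊔ w(γ₂) and
-- dΩ = max of the weights of the components.  By simultaneous induction on
-- formulas we show
--     d(A⁺) ≤ ord A        and        w(A⁻) ≤ ord A;
-- in particular w(A⁺) ≤ ord A + prod A, since prod(A⁺) = prod A.  The only
-- delicate point is a negative translation A⁻ placed under a ⊗ (in
-- (A \ B)⁻, (B / A)⁻, (□↓A)⁻): there its depth is raised by one, which is
-- paid for because A⁻ is itself a ⊗ exactly when A is not a product (or a
-- variable).  The bound for meta-formulas follows by induction, since dΩ
-- turns list concatenation into ⊔, and the theorem combines both bounds.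

open import Defs
open import Data.Nat using (ℕ; suc; _+_; _⊔_; _≤_; z≤n; s≤s)
open import Data.Nat.Properties
open import Data.List using (List; []; _∷_; _++_)
open import Relation.Binary.PropositionalEquality
  using (_≡_; refl; sym; cong)

w : Expr → ℕ
w γ = d γ + prodE γ

prod-pos : ∀ A → prodE (pos A) ≡ prodF A
prod-pos (var _) = refl
prod-pos (_ ⧵ _) = refl
prod-pos (_ ⁄ _) = refl
prod-pos (_ · _) = refl
prod-pos (⟨⟩ _)  = refl
prod-pos (□↓ _)  = refl

⅋-weight-bound : ∀ a b {o} → w a ≤ o → w b ≤ o → w (a ⅋ b) ≤ o
⅋-weight-bound a b wa≤o wb≤o rewrite +-identityʳ (w a ⊔ w b) =
  ⊔-lub wa≤o wb≤o

⊗-weight-bound : ∀ a b {o} → suc (d a) ≤ o → suc (d b) ≤ o → w (a ⊗ b) ≤ o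
⊗-weight-bound a b da<o db<o rewrite +-comm (d a ⊔ d b) 1 =
  ⊔-lub da<o db<o

suc≤1⊔+1 : ∀ x → suc x ≤ 1 ⊔ (x + 1)
suc≤1⊔+1 x = ≤-trans (≤-reflexive (+-comm 1 x)) (m≤n⊔m 1 (x + 1))

-- Unless A is a variable, exactly one of A (as a formula) and A⁻ (as an
-- expression) is a product; hence placing A⁻ under a ⊗ costs at most
-- the unit that prod A already accounts for.
neg-or-formula-product :
  ∀ A → suc (d (neg A)) ≤ 1 ⊔ (d (neg A) + (prodE (neg A) + prodF A))
neg-or-formula-product (var _) = ≤-refl
neg-or-formula-product (_ ⧵ _) = suc≤1⊔+1 _
neg-or-formula-product (_ ⁄ _) = suc≤1⊔+1 _
neg-or-formula-product (_ · _) = suc≤1⊔+1 _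
neg-or-formula-product (⟨⟩ _)  = suc≤1⊔+1 _
neg-or-formula-product (□↓ _)  = suc≤1⊔+1 _

neg-under-⊗ : ∀ A → w (neg A) ≤ ord A → suc (d (neg A)) ≤ 1 ⊔ (ord A + prodF A)
neg-under-⊗ A wA⁻≤ordA = begin
  suc (d (neg A))                                 ≤⟨ neg-or-formula-product A ⟩
  1 ⊔ (d (neg A) + (prodE (neg A) + prodF A))     ≡⟨ cong (1 ⊔_) (sym (+-assoc (d (neg A)) _ _)) ⟩
  1 ⊔ (w (neg A) + prodF A)                       ≤⟨ ⊔-monoʳ-≤ 1 (+-monoˡ-≤ (prodF A) wA⁻≤ordA) ⟩
  1 ⊔ (ord A + prodF A)                           ∎
  where open ≤-Reasoning

ord-imp-arg : ∀ A B → suc (ord A) ≤ suc (ord A) ⊔ (ord B + prodF B)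
ord-imp-arg A B = m≤m⊔n (suc (ord A)) (ord B + prodF B)

ord-imp-res : ∀ A B → ord B + prodF B ≤ suc (ord A) ⊔ (ord B + prodF B)
ord-imp-res A B = m≤n⊔m (suc (ord A)) (ord B + prodF B)

ord-imp-1⊔res : ∀ A B → 1 ⊔ (ord B + prodF B) ≤ suc (ord A) ⊔ (ord B + prodF B)
ord-imp-1⊔res A B = ⊔-monoˡ-≤ (ord B + prodF B) (s≤s z≤n)

mutual
  pos-depth : ∀ A → d (pos A) ≤ ord A
  pos-depth (var _) = z≤n
  pos-depth (A ⧵ B) = ⊔-lub (≤-trans (m≤n⇒m≤1+n (neg-weight A)) (ord-imp-arg A B))
                            (≤-trans (pos-weight B) (ord-imp-res A B))
  pos-depth (B ⁄ A) = ⊔-lub (≤-trans (pos-weight B) (ord-imp-res A B))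
                            (≤-trans (m≤n⇒m≤1+n (neg-weight A)) (ord-imp-arg A B))
  pos-depth (A · B) = ⊔-mono-≤ (pos-depth A) (pos-depth B)
  pos-depth (⟨⟩ A)  = ⊔-lub (pos-depth A) z≤n
  pos-depth (□↓ A)  = ⊔-lub (⅋-weight-bound (lit rb̄) (pos A) z≤n
                              (≤-trans (pos-weight A) (m≤m⊔n (ord A + prodF A) 1)))
                            z≤n

  pos-weight : ∀ A → w (pos A) ≤ ord A + prodF A
  pos-weight A rewrite prod-pos A = +-monoˡ-≤ (prodF A) (pos-depth A)

  neg-weight : ∀ A → w (neg A) ≤ ord A
  neg-weight (var _) = z≤n
  neg-weight (A ⧵ B) = ⊗-weight-bound (neg B) (pos A)
                         (≤-trans (neg-under-⊗ B (neg-weight B)) (ord-imp-1⊔res A B))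
                         (≤-trans (s≤s (pos-depth A)) (ord-imp-arg A B))
  neg-weight (B ⁄ A) = ⊗-weight-bound (pos A) (neg B)
                         (≤-trans (s≤s (pos-depth A)) (ord-imp-arg A B))
                         (≤-trans (neg-under-⊗ B (neg-weight B)) (ord-imp-1⊔res A B))
  neg-weight (A · B) = ⅋-weight-bound (neg B) (neg A)
                         (≤-trans (neg-weight B) (m≤n⊔m (ord A) (ord B)))
                         (≤-trans (neg-weight A) (m≤m⊔n (ord A) (ord B)))
  neg-weight (⟨⟩ A)  = ⅋-weight-bound (lit lb̄ ⅋ neg A) (lit rb̄)
                         (⅋-weight-bound (lit lb̄) (neg A) z≤n (neg-weight A)) z≤n
  neg-weight (□↓ A)  = ⊗-weight-bound (lit lb) (neg A ⊗ lit rb)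
                         (m≤n⊔m (ord A + prodF A) 1) (begin
    suc (d (neg A) ⊔ 0)          ≡⟨ cong suc (⊔-identityʳ (d (neg A))) ⟩
    suc (d (neg A))              ≤⟨ neg-under-⊗ A (neg-weight A) ⟩
    1 ⊔ (ord A + prodF A)        ≡⟨ ⊔-comm 1 _ ⟩
    (ord A + prodF A) ⊔ 1        ∎)
    where open ≤-Reasoning

dΩ-++ : ∀ xs ys → dΩ (xs ++ ys) ≡ dΩ xs ⊔ dΩ ys
dΩ-++ [] ys = refl
dΩ-++ (x ∷ xs) ys rewrite dΩ-++ xs ys = sym (⊔-assoc (w x) (dΩ xs) (dΩ ys))

negM-depth : ∀ Γ → dΩ (negM Γ) ≤ ordM Γ
negM-depth ε        = z≤n
negM-depth (fm A)   = ⊔-lub (neg-weight A) z≤n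
negM-depth (Γ ,, Δ) = begin
  dΩ (negM Δ ++ negM Γ)        ≡⟨ dΩ-++ (negM Δ) (negM Γ) ⟩
  dΩ (negM Δ) ⊔ dΩ (negM Γ)    ≤⟨ ⊔-mono-≤ (negM-depth Δ) (negM-depth Γ) ⟩
  ordM Δ ⊔ ordM Γ              ≡⟨ ⊔-comm (ordM Δ) (ordM Γ) ⟩
  ordM Γ ⊔ ordM Δ              ∎
  where open ≤-Reasoning
negM-depth [ Γ ]    = begin
  dΩ (negM Γ ++ lit rb̄ ∷ [])   ≡⟨ dΩ-++ (negM Γ) (lit rb̄ ∷ []) ⟩
  dΩ (negM Γ) ⊔ 0              ≡⟨ ⊔-identityʳ (dΩ (negM Γ)) ⟩
  dΩ (negM Γ)                  ≤⟨ negM-depth Γ ⟩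
  ordM Γ                       ∎
  where open ≤-Reasoning

lemma16 : (s : Sequent) → dΩ (Ω s) ≤ ordS s
lemma16 (Γ ⇒ C) = begin
  dΩ (negM Γ ++ pos C ∷ [])             ≡⟨ dΩ-++ (negM Γ) (pos C ∷ []) ⟩
  dΩ (negM Γ) ⊔ (w (pos C) ⊔ 0)         ≤⟨ ⊔-mono-≤ (m≤n⇒m≤1+n (negM-depth Γ))
                                                    (⊔-lub (pos-weight C) z≤n) ⟩
  suc (ordM Γ) ⊔ (ord C + prodF C)      ∎
  where open ≤-Reasoning
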